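{- Let $k>2$ be even and let $\mathfrak M_0=\langle S_0,L_0,\mathrm I_0\rangle$ be a self dual partial linear space with an involutive correlation $\varkappa_0$. Then $\mathfrak M_0\circledast_\circ C_k\cong \mathfrak M_0\circledast_{\varkappa_0}k$.
   Context: PLS: incidence structure $\langle S,\mathcal L,\mathrm I\rangle$, $S\cap\mathcal L=\emptyset$, every line on at least two points, every point on at least two lines, two distinct points on at most one common line. A correlation $\varkappa_0$ of $\mathfrak M_0$ is a pair of bijections $S_0\to L_0$, $L_0\to S_0$ (both denoted $\varkappa_0$) with $a\,\mathrm I_0\,l\iff\varkappa_0(l)\,\mathrm I_0\,\varkappa_0(a)$; involutive means $\varkappa_0(\varkappa_0(x))=x$ for all points and lines $x$. Dual multiplying $\mathfrak M_0\circledast_\circ C_k$: point set $\bigcup_{i\in C_k}M_i$, line set $\bigcup_{i}\mathcal L_i$, where $M_i=\{i\}\times S_0$, $\mathcal L_i=\{i\}\times L_0$ for even $i$ and $M_i=\{i\}\times L_0$, $\mathcal L_i=\{i\}\times S_0$ for odd $i$; points $(i,a)$, lines $[j,b]$, $(i,a)\,\mathrm I\,[j,b]$ iff either $i=j$ and ($a\,\mathrm I_0\,b$ or $b\,\mathrm I_0\,a$), or $i=j+1$ and $a=b$. Correlative multiplying $\mathfrak M_0\circledast_{\varkappa_0}k$: point set $C_k\times S_0$ (points $(i,a)$), line set $C_k\times L_0$ (lines $[i,l]$), $(i,a)\,\mathrm I\,[j,l]$ iff either $i=j$ and $a\,\mathrm I_0\,l$, or $i=j+1$ and $a=\varkappa_0(l)$.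 -}

module Defs where

open import Data.Nat using (ℕ; zero; suc)
open import Data.Nat.DivMod using (_mod_)
open import Data.Fin using (Fin; toℕ)
open import Data.Bool using (Bool; true; false; not)
open import Data.Product using (Σ; ∃; ∃-syntax; _×_; _,_)
open import Data.Sum using (_⊎_; inj₁; inj₂)
open import Data.Empty using (⊥)
open import Relation.Nullary using (¬_)
open import Relation.Binary.PropositionalEquality using (_≡_)
open import Function.Bundles using (_⇔_; _⤖_; Bijection)
open import Function.Definitions using (Bijective)

-- An incidence structure ⟨S, L, I⟩; points and lines are distinct types
-- (so S ∩ L = ∅ holds by construction).
record IncStr : Set₁ where
  field
    Point : Set
    Line  : Set
    _I_   : Point → Line → Set

open IncStr public

record IsPLS (M : IncStr) : Set where
  open IncStr M renaming (Point to P; Line to L; _I_ to _∣_)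
  field
    line-two-points : ∀ (l : L) → ∃[ a ] ∃[ b ] (¬ a ≡ b × a ∣ l × b ∣ l)
    point-two-lines : ∀ (a : P) → ∃[ l ] ∃[ m ] (¬ l ≡ m × a ∣ l × a ∣ m)
    at-most-one-line : ∀ {a b : P} {l m : L} → ¬ a ≡ b →
      a ∣ l → b ∣ l → a ∣ m → b ∣ m → l ≡ m

-- A correlation: a pair of bijections S → L and L → S (both written κ)
-- with a I l ⟺ κ(l) I κ(a).
record Correlation (M : IncStr) : Set where
  open IncStr M renaming (Point to P; Line to L; _I_ to _∣_)
  field
    κₚ : P → L
    κₗ : L → P
    κₚ-bij : Bijective _≡_ _≡_ κₚ
    κₗ-bij : Bijective _≡_ _≡_ κₗ
    κ-inc : ∀ (a : P) (l : L) → (a ∣ l) ⇔ (κₗ l ∣ κₚ a)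

open Correlation public

Involutive : {M : IncStr} → Correlation M → Set
Involutive {M} κ = (∀ (a : Point M) → κₗ κ (κₚ κ a) ≡ a)
                 × (∀ (l : Line M) → κₚ κ (κₗ κ l) ≡ l)

SelfDual : IncStr → Set
SelfDual M = Correlation M

record _≅_ (M N : IncStr) : Set where
  field
    φ : Point M ⤖ Point N
    ψ : Line M ⤖ Line N
    pres : ∀ (a : Point M) (l : Line M) →
      _I_ M a l ⇔ _I_ N (Bijection.to φ a) (Bijection.to ψ l)

-- The cyclic group C_k realised as Fin k; next i = i + 1 (mod k).
next : ∀ {k} → Fin k → Fin k
next {suc n} i = suc (toℕ i) mod (suc n)

isEven : ℕ → Bool
isEven zero = true
isEven (suc n) = not (isEven n)

par : ∀ {k} → Fin k → Bool
par i = isEven (toℕ i)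

module _ (M₀ : IncStr) where
  open IncStr M₀ renaming (Point to S₀; Line to L₀; _I_ to _I₀_)

  Side : Bool → Set
  Side true  = S₀
  Side false = L₀

  emb : (p : Bool) → Side p → S₀ ⊎ L₀
  emb true  a = inj₁ a
  emb false l = inj₂ l

  incU : S₀ ⊎ L₀ → S₀ ⊎ L₀ → Set
  incU (inj₁ a) (inj₂ l) = a I₀ l
  incU (inj₂ l) (inj₁ a) = a I₀ l
  incU (inj₁ _) (inj₁ _) = ⊥
  incU (inj₂ _) (inj₂ _) = ⊥

  -- Dual multiplying  M₀ ⊛∘ C_k.
  -- M_i = {i} × S₀ (i even), {i} × L₀ (i odd);  𝓛_i the other one.
  dualMult : ℕ → IncStr
  dualMult k = record
    { Point = Σ (Fin k) (λ i → Side (par i))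
    ; Line  = Σ (Fin k) (λ j → Side (not (par j)))
    ; _I_   = λ { (i , a) (j , b) →
                 (i ≡ j × incU (emb (par i) a) (emb (not (par j)) b))
               ⊎ (i ≡ next j × emb (par i) a ≡ emb (not (par j)) b) }
    }

  corrMult : Correlation M₀ → ℕ → IncStr
  corrMult κ k = record
    { Point = Fin k × S₀
    ; Line  = Fin k × L₀
    ; _I_   = λ { (i , a) (j , l) →
                 (i ≡ j × a I₀ l) ⊎ (i ≡ next j × a ≡ κₗ κ l) }
    }

-- Colour the index i ∈ C_k by its parity. Reading every element of an odd
-- layer through the involutive correlation κ (a line of M₀ as the point κ l,
-- a point as the line κ a) turns each layer of the dual multiplying into a
-- copy of M₀, and turns the connecting identifications a = b between layers
-- j + 1 and j into a = κ l. Because k is even, the parity alternates along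
-- the whole cycle, including the step from k − 1 back to 0, so every
-- connection joins layers of opposite colour and the recoding is uniform.
module Submission where

open import Defs
open import Data.Nat using (ℕ; _<_)
open import Data.Nat.Divisibility using (_∣_)

open import Data.Nat using (zero; suc; _*_; s≤s)
open import Data.Nat.Properties using (_≟_; ≤∧≢⇒<; ≤-pred)
open import Data.Nat.DivMod using (_%_; m%n<n; m<n⇒m%n≡m; n%n≡0)
open import Data.Nat.Divisibility using (divides)
open import Data.Fin using (Fin; toℕ)
open import Data.Fin.Properties using (toℕ-fromℕ<; toℕ<n)
open import Data.Bool using (Bool; true; false; not)
open import Data.Bool.Properties using (not-involutive)
open import Data.Product using (_,_; proj₁; proj₂)
open import Data.Product.Function.Dependent.Propositional using (Σ-↔)
import Data.Sum as Sum
open import Data.Sum.Properties using (inj₁-injective; inj₂-injective)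
open import Relation.Binary.PropositionalEquality
open import Relation.Nullary using (Dec; yes; no)
open import Function using (_∘′_)
open import Function.Bundles using (_⇔_; mk⇔; _↔_; mk↔ₛ′; Equivalence; Inverse)
open import Function.Construct.Identity using (↔-id; ⇔-id)
open import Function.Properties.Inverse using (↔⇒⤖)

isEven-*2 : ∀ q → isEven (q * 2) ≡ true
isEven-*2 zero    = refl
isEven-*2 (suc q) = trans (not-involutive (isEven (q * 2))) (isEven-*2 q)

isEven-even : ∀ {m} → 2 ∣ m → isEven m ≡ true
isEven-even (divides q refl) = isEven-*2 q

par-next : ∀ {k} → 2 ∣ k → (j : Fin k) → par (next j) ≡ not (par j)
par-next {suc n} 2∣k j =
  trans (cong isEven (toℕ-fromℕ< (m%n<n (suc (toℕ j)) (suc n)))) (isEven-suc% (toℕ j ≟ n))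
  where
  open ≡-Reasoning
  isEven-suc% : Dec (toℕ j ≡ n) → isEven (suc (toℕ j) % suc n) ≡ not (isEven (toℕ j))
  isEven-suc% (yes j≡n) = begin
    isEven (suc (toℕ j) % suc n) ≡⟨ cong (λ m → isEven (suc m % suc n)) j≡n ⟩
    isEven (suc n % suc n)       ≡⟨ cong isEven (n%n≡0 (suc n)) ⟩
    true                         ≡⟨ isEven-even 2∣k ⟨
    not (isEven n)               ≡⟨ cong (λ m → not (isEven m)) j≡n ⟨
    not (isEven (toℕ j))         ∎
  isEven-suc% (no j≢n) = cong isEven (m<n⇒m%n≡m (s≤s (≤∧≢⇒< (≤-pred (toℕ<n j)) j≢n)))

module _ {M₀ : IncStr} (κ : Correlation M₀) (κ-invol : Involutive κ) where
  open IncStr M₀ renaming (Point to S₀; Line to L₀; _I_ to _I₀_)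

  sideAsPoint : (b : Bool) → Side M₀ b ↔ S₀
  sideAsPoint true  = ↔-id S₀
  sideAsPoint false = mk↔ₛ′ (κₗ κ) (κₚ κ) (proj₁ κ-invol) (proj₂ κ-invol)

  sideAsLine : (b : Bool) → Side M₀ (not b) ↔ L₀
  sideAsLine true  = ↔-id L₀
  sideAsLine false = mk↔ₛ′ (κₚ κ) (κₗ κ) (proj₂ κ-invol) (proj₁ κ-invol)

  asPoint : (b : Bool) → Side M₀ b → S₀
  asPoint b = Inverse.to (sideAsPoint b)

  asLine : (b : Bool) → Side M₀ (not b) → L₀
  asLine b = Inverse.to (sideAsLine b)

  incU⇔I₀ : (p q : Bool) → q ≡ p → (a : Side M₀ q) (l : Side M₀ (not p)) →
            incU M₀ (emb M₀ q a) (emb M₀ (not p) l) ⇔ (asPoint q a I₀ asLine p l)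
  incU⇔I₀ true  .true  refl a l = ⇔-id _
  incU⇔I₀ false .false refl a l = κ-inc κ l a

  emb≡⇔≡κₗ : (p q : Bool) → q ≡ not p → (a : Side M₀ q) (l : Side M₀ (not p)) →
             (emb M₀ q a ≡ emb M₀ (not p) l) ⇔ (asPoint q a ≡ κₗ κ (asLine p l))
  emb≡⇔≡κₗ true  .false refl a l =
    mk⇔ (cong (κₗ κ) ∘′ inj₂-injective) (cong Sum.inj₂ ∘′ proj₁ (κₗ-bij κ))
  emb≡⇔≡κₗ false .true  refl a l =
    mk⇔ (λ e → trans (inj₁-injective e) (sym (proj₁ κ-invol l)))
        (λ e → cong Sum.inj₁ (trans e (proj₁ κ-invol l)))

  module _ {k : ℕ} (2∣k : 2 ∣ k) where
    dualMult-I⇔corrMult-I :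
      ∀ i a j l → _I_ (dualMult M₀ k) (i , a) (j , l)
                ⇔ _I_ (corrMult M₀ κ k) (i , asPoint (par i) a) (j , asLine (par j) l)
    dualMult-I⇔corrMult-I i a j l = mk⇔
      (Sum.map (λ (e , x) → e , Equivalence.to   (inLayer e) x)
               (λ (e , x) → e , Equivalence.to   (acrossLayers e) x))
      (Sum.map (λ (e , x) → e , Equivalence.from (inLayer e) x)
               (λ (e , x) → e , Equivalence.from (acrossLayers e) x))
      where
      inLayer : i ≡ j → incU M₀ (emb M₀ (par i) a) (emb M₀ (not (par j)) l)
                      ⇔ (asPoint (par i) a I₀ asLine (par j) l)
      inLayer e = incU⇔I₀ (par j) (par i) (cong par e) a l

      acrossLayers : i ≡ next j → (emb M₀ (par i) a ≡ emb M₀ (not (par j)) l)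
                                ⇔ (asPoint (par i) a ≡ κₗ κ (asLine (par j) l))
      acrossLayers e = emb≡⇔≡κₗ (par j) (par i) (trans (cong par e) (par-next 2∣k j)) a l

proposition2p5 : (k : ℕ) → 2 < k → 2 ∣ k →
    (M₀ : IncStr) → IsPLS M₀ → SelfDual M₀ →
    (κ₀ : Correlation M₀) → Involutive κ₀ →
    dualMult M₀ k ≅ corrMult M₀ κ₀ k
proposition2p5 k _ 2∣k M₀ _ _ κ₀ κ₀-invol = record
  { φ    = ↔⇒⤖ (Σ-↔ (↔-id (Fin k)) (λ {i} → sideAsPoint κ₀ κ₀-invol (par i)))
  ; ψ    = ↔⇒⤖ (Σ-↔ (↔-id (Fin k)) (λ {j} → sideAsLine κ₀ κ₀-invol (par j)))
  ; pres = λ (i , a) (j , l) → dualMult-I⇔corrMult-I κ₀ κ₀-invol 2∣k i a j l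
  }
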